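{- (1) If $a$ is a Noetherian element of a modal semiring, then $a$ converges: the divergence $\nabla a$ exists and $\nabla a=0$. (2) Every convergent element of a divergence semiring is Noetherian.
   Context: An idempotent semiring is a structure $(S,+,\cdot,0,1)$ such that $(S,+,0)$ is a commutative monoid with $a+a=a$, $(S,\cdot,1)$ is a monoid, multiplication distributes over addition from both sides, and $0a=a0=0$; natural order $a\le b\iff a+b=b$. A test is an element $p\le 1$ for which some $q$ satisfies $p+q=1$ and $pq=0=qp$; $q$ is unique, written $\neg p$; tests form a Boolean algebra $\mathrm{test}(S)$; $p-q=p\cdot\neg q$. $S$ is a modal semiring if for each $a\in S$ there are maps $|a\rangle,\langle a|$ on $\mathrm{test}(S)$ with, for all $a,b,p,q$: $|a\rangle p\le q\iff \neg q\,a\,p\le 0$; $\langle a|p\le q\iff p\,a\,\neg q\le 0$; $|ab\rangle p=|a\rangle(|b\rangle p)$; $\langle ab|p=\langle b|(\langle a|p)$. An element $a$ is Noetherian if for all tests $p$, $p-|a\rangle p\le 0$ implies $p\le 0$. A test $\nabla a$ is the divergence of $a$ if $\nabla a\le|a\rangle\nabla a$ and for every test $p$, $p\le|a\rangle p\Rightarrow p\le\nabla a$; $a$ is convergent if $\nabla a$ exists and $\nabla a=0$. A divergence semiring is a modal semiring in which $\nabla a$ exists for every $a$. -}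

module Defs where

open import Level using (Level; suc; _⊔_)
open import Relation.Binary.PropositionalEquality using (_≡_)
open import Data.Product using (Σ; _×_; _,_; proj₁)
open import Function.Bundles using (_⇔_)

record IdempotentSemiring (ℓ : Level) : Set (suc ℓ) where
  infixl 6 _+_
  infixl 7 _·_
  field
    S    : Set ℓ
    _+_  : S → S → S
    _·_  : S → S → S
    𝟘    : S
    𝟙    : S
    +-assoc : ∀ a b c → (a + b) + c ≡ a + (b + c)
    +-comm  : ∀ a b → a + b ≡ b + a
    +-idˡ   : ∀ a → 𝟘 + a ≡ a
    +-idem  : ∀ a → a + a ≡ a
    ·-assoc : ∀ a b c → (a · b) · c ≡ a · (b · c)
    ·-idˡ   : ∀ a → 𝟙 · a ≡ a
    ·-idʳ   : ∀ a → a · 𝟙 ≡ a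
    distribˡ : ∀ a b c → a · (b + c) ≡ a · b + a · c
    distribʳ : ∀ a b c → (b + c) · a ≡ b · a + c · a
    zeroˡ   : ∀ a → 𝟘 · a ≡ 𝟘
    zeroʳ   : ∀ a → a · 𝟘 ≡ 𝟘

  infix 4 _≤_
  infixl 6 _-ₜ_
  _≤_ : S → S → Set ℓ
  a ≤ b = a + b ≡ b

  -- tests: p ≤ 1 together with a complement q (unique when it exists)
  record Test : Set ℓ where
    field
      elt  : S
      elt≤𝟙 : elt ≤ 𝟙
      cmp  : S
      sum𝟙 : elt + cmp ≡ 𝟙
      ann₁ : elt · cmp ≡ 𝟘
      ann₂ : cmp · elt ≡ 𝟘

  open Test public

  ⌊_⌋ : Test → S
  ⌊ p ⌋ = elt p

  ¬ₜ : Test → S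
  ¬ₜ p = cmp p

  _-ₜ_ : Test → Test → S
  p -ₜ q = ⌊ p ⌋ · ¬ₜ q

record ModalSemiring (ℓ : Level) : Set (suc ℓ) where
  field
    semiring : IdempotentSemiring ℓ
  open IdempotentSemiring semiring public
  field
    fdia : S → Test → Test
    bdia : S → Test → Test
    fdia-ax : ∀ a p q → (⌊ fdia a p ⌋ ≤ ⌊ q ⌋) ⇔ ((¬ₜ q · a) · ⌊ p ⌋ ≤ 𝟘)
    bdia-ax : ∀ a p q → (⌊ bdia a p ⌋ ≤ ⌊ q ⌋) ⇔ ((⌊ p ⌋ · a) · ¬ₜ q ≤ 𝟘)
    fdia-· : ∀ a b p → ⌊ fdia (a · b) p ⌋ ≡ ⌊ fdia a (fdia b p) ⌋
    bdia-· : ∀ a b p → ⌊ bdia (a · b) p ⌋ ≡ ⌊ bdia b (bdia a p) ⌋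

  Noetherian : S → Set ℓ
  Noetherian a = ∀ (p : Test) → p -ₜ fdia a p ≤ 𝟘 → ⌊ p ⌋ ≤ 𝟘

  IsDivergence : S → Test → Set ℓ
  IsDivergence a d =
    (⌊ d ⌋ ≤ ⌊ fdia a d ⌋) ×
    (∀ (p : Test) → ⌊ p ⌋ ≤ ⌊ fdia a p ⌋ → ⌊ p ⌋ ≤ ⌊ d ⌋)

  Convergent : S → Set ℓ
  Convergent a = Σ Test λ d → IsDivergence a d × (⌊ d ⌋ ≡ 𝟘)

  IsDivergenceSemiring : Set ℓ
  IsDivergenceSemiring = ∀ a → Σ Test λ d → IsDivergence a d

-- Both notions talk about the tests p that are "postfixed" for the forward
-- diamond of a, i.e. satisfy p ≤ |a⟩p:
--   * a is Noetherian  iff  every postfixed test is 0, because in the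
--     Boolean algebra of tests  p ≤ q  is equivalent to  p · ¬q ≤ 0;
--   * ∇a is by definition the greatest postfixed test, so a is convergent
--     iff the zero test is a divergence of a, iff every postfixed test is 0.
-- The file first proves the order facts about tests in an arbitrary
-- idempotent semiring (subidentities decrease what they multiply; the
-- comparison p ≤ q of tests is the vanishing of p - q), then the two
-- characterisations above in a modal semiring. The theorem combines them;
-- part (2) does not even need the assumption that every element has a
-- divergence.
module Submission where

open import Defs
open import Level using (Level)
open import Data.Product using (_×_; _,_)
open import Relation.Binary.PropositionalEquality
  using (_≡_; refl; sym; trans; cong; subst; module ≡-Reasoning)
open import Function.Bundles using (_⇔_; mk⇔; module Equivalence)

module TestOrder {ℓ : Level} (R : IdempotentSemiring ℓ) where
  open IdempotentSemiring R
  open ≡-Reasoning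

  +-idʳ : ∀ a → a + 𝟘 ≡ a
  +-idʳ a = trans (+-comm a 𝟘) (+-idˡ a)

  𝟘-least : ∀ a → 𝟘 ≤ a
  𝟘-least = +-idˡ

  ≤𝟘⇒≡𝟘 : ∀ {a} → a ≤ 𝟘 → a ≡ 𝟘
  ≤𝟘⇒≡𝟘 {a} a≤𝟘 = trans (sym (+-idʳ a)) a≤𝟘

  𝟘ₜ : Test
  𝟘ₜ = record { elt = 𝟘 ; elt≤𝟙 = +-idˡ 𝟙 ; cmp = 𝟙 ; sum𝟙 = +-idˡ 𝟙
              ; ann₁ = zeroˡ 𝟙 ; ann₂ = zeroʳ 𝟙 }

  subidentity-decreasing : ∀ {a} b → a ≤ 𝟙 → a · b ≤ b
  subidentity-decreasing {a} b a≤𝟙 = begin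
    a · b + b      ≡⟨ cong (a · b +_) (sym (·-idˡ b)) ⟩
    a · b + 𝟙 · b  ≡⟨ sym (distribʳ b a 𝟙) ⟩
    (a + 𝟙) · b    ≡⟨ cong (_· b) a≤𝟙 ⟩
    𝟙 · b          ≡⟨ ·-idˡ b ⟩
    b              ∎

  diff-zero⇒meet : (p q : Test) → p -ₜ q ≡ 𝟘 → ⌊ p ⌋ ≡ ⌊ p ⌋ · ⌊ q ⌋
  diff-zero⇒meet p q p-q≡𝟘 = begin
    elt p                         ≡⟨ sym (·-idʳ (elt p)) ⟩
    elt p · 𝟙                     ≡⟨ cong (elt p ·_) (sym (sum𝟙 q)) ⟩
    elt p · (elt q + cmp q)       ≡⟨ distribˡ (elt p) (elt q) (cmp q) ⟩
    elt p · elt q + elt p · cmp q ≡⟨ cong (elt p · elt q +_) p-q≡𝟘 ⟩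
    elt p · elt q + 𝟘             ≡⟨ +-idʳ _ ⟩
    elt p · elt q                 ∎

  below⇒diff-zero : (p q : Test) → ⌊ p ⌋ ≤ ⌊ q ⌋ → p -ₜ q ≡ 𝟘
  below⇒diff-zero p q p≤q = begin
    elt p · cmp q                 ≡⟨ sym (+-idʳ _) ⟩
    elt p · cmp q + 𝟘             ≡⟨ cong (elt p · cmp q +_) (sym (ann₁ q)) ⟩
    elt p · cmp q + elt q · cmp q ≡⟨ sym (distribʳ (cmp q) (elt p) (elt q)) ⟩
    (elt p + elt q) · cmp q       ≡⟨ cong (_· cmp q) p≤q ⟩
    elt q · cmp q                 ≡⟨ ann₁ q ⟩
    𝟘                             ∎

  below⇔diff-zero : (p q : Test) → (⌊ p ⌋ ≤ ⌊ q ⌋) ⇔ (p -ₜ q ≤ 𝟘)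
  below⇔diff-zero p q = mk⇔ to from
    where
    to : ⌊ p ⌋ ≤ ⌊ q ⌋ → p -ₜ q ≤ 𝟘
    to p≤q = subst (λ x → x ≤ 𝟘) (sym (below⇒diff-zero p q p≤q)) (+-idˡ 𝟘)

    from : p -ₜ q ≤ 𝟘 → ⌊ p ⌋ ≤ ⌊ q ⌋
    from p-q≤𝟘 = subst (λ x → x + elt q ≡ elt q)
                       (sym (diff-zero⇒meet p q (≤𝟘⇒≡𝟘 p-q≤𝟘)))
                       (subidentity-decreasing (elt q) (elt≤𝟙 p))

module Convergence {ℓ : Level} (M : ModalSemiring ℓ) where
  open ModalSemiring M
  open TestOrder semiring

  Postfixed : S → Test → Set ℓ
  Postfixed a p = ⌊ p ⌋ ≤ ⌊ fdia a p ⌋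

  OnlyZeroPostfixed : S → Set ℓ
  OnlyZeroPostfixed a = ∀ p → Postfixed a p → ⌊ p ⌋ ≤ 𝟘

  noetherian⇔onlyZeroPostfixed : ∀ a → Noetherian a ⇔ OnlyZeroPostfixed a
  noetherian⇔onlyZeroPostfixed a = mk⇔
    (λ noeth p p≤|a⟩p → noeth p (Equivalence.to (below⇔diff-zero p (fdia a p)) p≤|a⟩p))
    (λ only p p-|a⟩p≤𝟘 → only p (Equivalence.from (below⇔diff-zero p (fdia a p)) p-|a⟩p≤𝟘))

  onlyZeroPostfixed⇒convergent : ∀ a → OnlyZeroPostfixed a → Convergent a
  onlyZeroPostfixed⇒convergent a only = 𝟘ₜ , (𝟘-least _ , only) , refl

  convergent⇒onlyZeroPostfixed : ∀ a → Convergent a → OnlyZeroPostfixed a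
  convergent⇒onlyZeroPostfixed a (d , (_ , greatest) , d≡𝟘) p p≤|a⟩p =
    subst (λ x → ⌊ p ⌋ ≤ x) d≡𝟘 (greatest p p≤|a⟩p)

lemma7p5 : ∀ {ℓ : Level}
    → ((M : ModalSemiring ℓ) → ∀ a
        → ModalSemiring.Noetherian M a → ModalSemiring.Convergent M a)
    × ((M : ModalSemiring ℓ) → ModalSemiring.IsDivergenceSemiring M → ∀ a
        → ModalSemiring.Convergent M a → ModalSemiring.Noetherian M a)
lemma7p5 = noetherian⇒convergent , convergent⇒noetherian
  where
  noetherian⇒convergent : ∀ {ℓ} (M : ModalSemiring ℓ) → ∀ a
    → ModalSemiring.Noetherian M a → ModalSemiring.Convergent M a
  noetherian⇒convergent M a noeth =
    onlyZeroPostfixed⇒convergent a (Equivalence.to (noetherian⇔onlyZeroPostfixed a) noeth)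
    where open Convergence M

  convergent⇒noetherian : ∀ {ℓ} (M : ModalSemiring ℓ) → ModalSemiring.IsDivergenceSemiring M
    → ∀ a → ModalSemiring.Convergent M a → ModalSemiring.Noetherian M a
  convergent⇒noetherian M _ a conv =
    Equivalence.from (noetherian⇔onlyZeroPostfixed a) (convergent⇒onlyZeroPostfixed a conv)
    where open Convergence M
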